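{- Let $X,Y$ be Gamma-LD graphs. (a) If $X\gg Y$, then the graph $(X\,(Y))$ is valid. (b) If $\underline X,\underline Y$ are alternate graphs with $\underline X\gg\underline Y$, then the graph $[\underline X\,(\underline Y)]$ is valid.
   Context: Gamma-LD graphs: built from the empty graph $\lambda$ and atoms (classical atoms $a,b,\dots$ and alternate atoms $\underline a,\underline b,\dots$) by juxtaposition $XY$ (commutative, associative), classical cut $(X)$ and alternate cut $[X]$. Alternate graphs $\underline X$: alternate atoms or graphs $[Y]$. An occurrence lies in an even (odd) region if enclosed by an even (odd) number of cuts of either kind, and in a classical region if enclosed by no alternate cut. A rule $X\Rightarrow Y$ (with a region condition) allows replacing an occurrence of $X$ satisfying the condition by $Y$; $\Leftrightarrow$ means both directions anywhere. Rules: R$\lambda$: $\lambda$ valid; $XY$ in even region $\Rightarrow X$ or $Y$; $X$ in odd region $\Rightarrow XY$ or $YX$; $X\Leftrightarrow((X))$; $[X]$ in even region $\Rightarrow(X)$ and $(X)$ in odd region $\Rightarrow[X]$; if $X$ is valid, $X\Leftrightarrow[(X)]$; $\underline X$ in even region $\Rightarrow[(\underline X)]$ and $[(\underline X)]$ in odd region $\Rightarrow\underline X$; $X\Rightarrow XX$; $XX\Rightarrow X$; $X\,G_n(Y)\Leftrightarrow X\,G_n(XY)$ for $X,Y$ in classical regions, where $G_0(Y)=Y_0Y$, $G_{k+1}(Y)=Y_{k+1}(G_k(Y))$; $\underline X\,H_n(Y)\Leftrightarrow\underline X\,H_n(\underline XY)$ where $H_0(Y)=Y_0Y$, $H_{k+1}(Y)=Y_{k+1}\{H_k(Y)\}$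 with each $\{\cdot\}$ a classical or alternate cut. $X\gg Z$ means $X$ is transformed into $Z$ by finitely many rule applications; $X$ is valid if $\lambda\gg X$. -}

module Defs where

open import Data.Nat using (ℕ)
open import Data.Bool using (Bool; true; false; not)
open import Data.List using (List; []; _∷_; _++_; [_])
open import Data.Unit using (⊤)
open import Data.Empty using (⊥)
open import Relation.Binary.PropositionalEquality using (_≡_)
open import Data.List.Relation.Binary.Permutation.Propositional using (_↭_)

-- A graph is a juxtaposition of items; juxtaposition is
-- list concatenation, and commutativity/associativity is handled by the
-- permutation rule `perm` below (graphs are taken up to reordering at
-- every level).  The empty graph λ is [].
mutual
  data Item : Set where
    atom  : ℕ → Item
    aatom : ℕ → Item
    ccut  : Graph → Item      -- classical cut (X)
    acut  : Graph → Item      -- alternate cut [X]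

  Graph : Set
  Graph = List Item

data IsAlt : Graph → Set where
  alt-atom : ∀ n → IsAlt [ aatom n ]
  alt-cut  : ∀ Y → IsAlt [ acut Y ]

-- Contexts: a position (region) inside a graph, together with the items
-- juxtaposed next to the occurrence at every level.
data Ctx : Set where
  here : Graph → Ctx
  inC  : Graph → Ctx → Ctx
  inA  : Graph → Ctx → Ctx

plug : Ctx → Graph → Graph
plug (here R)  X = X ++ R
plug (inC R C) X = ccut (plug C X) ∷ R
plug (inA R C) X = acut (plug C X) ∷ R

-- parity of the number of enclosing cuts (of either kind): true = even
parity : Ctx → Bool
parity (here _)  = true
parity (inC _ C) = not (parity C)
parity (inA _ C) = not (parity C)

EvenR : Ctx → Set
EvenR C = parity C ≡ true

OddR : Ctx → Set
OddR C = parity C ≡ false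

Classical : Ctx → Set
Classical (here _)  = ⊤
Classical (inC _ C) = Classical C
Classical (inA _ C) = ⊥

data GCtx : Set where
  g0   : Graph → GCtx
  gsuc : Graph → GCtx → GCtx

fillG : GCtx → Graph → Graph
fillG (g0 Y₀)     Y = Y₀ ++ Y
fillG (gsuc Yk G) Y = Yk ++ [ ccut (fillG G Y) ]

data HCtx : Set where
  h0    : Graph → HCtx
  hsucC : Graph → HCtx → HCtx
  hsucA : Graph → HCtx → HCtx

fillH : HCtx → Graph → Graph
fillH (h0 Y₀)      Y = Y₀ ++ Y
fillH (hsucC Yk H) Y = Yk ++ [ ccut (fillH H Y) ]
fillH (hsucA Yk H) Y = Yk ++ [ acut (fillH H Y) ]

-- One rule application, and X ≫ Z (finitely many rule applications).
-- Validity is mutually defined since one rule depends on validity.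
infix 4 _⟶_ _≫_

mutual
  data _⟶_ : Graph → Graph → Set where
    perm      : ∀ C {X X'} → X ↭ X' → plug C X ⟶ plug C X'
    erase₁    : ∀ C X Y → EvenR C → plug C (X ++ Y) ⟶ plug C X
    erase₂    : ∀ C X Y → EvenR C → plug C (X ++ Y) ⟶ plug C Y
    insert₁   : ∀ C X Y → OddR C → plug C X ⟶ plug C (X ++ Y)
    insert₂   : ∀ C X Y → OddR C → plug C X ⟶ plug C (Y ++ X)
    dcut-in   : ∀ C X → plug C X ⟶ plug C [ ccut [ ccut X ] ]
    dcut-out  : ∀ C X → plug C [ ccut [ ccut X ] ] ⟶ plug C X
    a→c       : ∀ C X → EvenR C → plug C [ acut X ] ⟶ plug C [ ccut X ]
    c→a       : ∀ C X → OddR C → plug C [ ccut X ] ⟶ plug C [ acut X ]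
    valid-in  : ∀ C X → Valid X → plug C X ⟶ plug C [ acut [ ccut X ] ]
    valid-out : ∀ C X → Valid X → plug C [ acut [ ccut X ] ] ⟶ plug C X
    alt-in    : ∀ C X → IsAlt X → EvenR C → plug C X ⟶ plug C [ acut [ ccut X ] ]
    alt-out   : ∀ C X → IsAlt X → OddR C → plug C [ acut [ ccut X ] ] ⟶ plug C X
    dup       : ∀ C X → plug C X ⟶ plug C (X ++ X)
    dedup     : ∀ C X → plug C (X ++ X) ⟶ plug C X
    iter      : ∀ C X G Y → Classical C →
                plug C (X ++ fillG G Y) ⟶ plug C (X ++ fillG G (X ++ Y))
    deiter    : ∀ C X G Y → Classical C →
                plug C (X ++ fillG G (X ++ Y)) ⟶ plug C (X ++ fillG G Y)
    alt-iter   : ∀ C X H Y → IsAlt X →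
                 plug C (X ++ fillH H Y) ⟶ plug C (X ++ fillH H (X ++ Y))
    alt-deiter : ∀ C X H Y → IsAlt X →
                 plug C (X ++ fillH H (X ++ Y)) ⟶ plug C (X ++ fillH H Y)

  data _≫_ : Graph → Graph → Set where
    done : ∀ {X} → X ≫ X
    step : ∀ {X Y Z} → X ⟶ Y → Y ≫ Z → X ≫ Z

  Valid : Graph → Set
  Valid X = [] ≫ X

{-# OPTIONS --safe #-}
-- For (a): from λ create (()) by double cut, insert X into the odd
-- region to get (X()), iterate X into the inner cut to get (X(X)), and
-- replay the derivation X ≫ Y inside the doubly enclosed cut, which is an
-- even classical region, so every rule application remains legal there.
-- For (b): the valid graph (X(Y)) may be replaced by [((X(Y)))], and
-- removing the double cut leaves [X(Y)].
module Submission where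

open import Defs
open import Data.Product using (_×_; _,_)
open import Data.List using ([]; _∷_; [_]; _++_)
open import Data.List.Properties using (++-identityʳ; ++-assoc)
open import Data.List.Relation.Binary.Permutation.Propositional.Properties
  using (++-comm)
open import Data.Bool using (not; _xor_)
open import Data.Bool.Properties using (not-distribˡ-xor)
open import Data.Unit using (tt)
open import Relation.Binary.Bundles using (Preorder)
open import Relation.Binary.Structures using (IsPreorder)
open import Relation.Binary.PropositionalEquality
  using (_≡_; refl; sym; trans; cong; subst₂)
open import Relation.Binary.PropositionalEquality.Properties using (isEquivalence)

juxtapose : Ctx → Graph → Ctx
juxtapose (here R′)  R = here (R′ ++ R)
juxtapose (inC R′ D) R = inC (R′ ++ R) D
juxtapose (inA R′ D) R = inA (R′ ++ R) D

infixr 5 _⊙_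

_⊙_ : Ctx → Ctx → Ctx
here R  ⊙ D = juxtapose D R
inC R E ⊙ D = inC R (E ⊙ D)
inA R E ⊙ D = inA R (E ⊙ D)

plug-juxtapose : ∀ D R Z → plug (juxtapose D R) Z ≡ plug D Z ++ R
plug-juxtapose (here R′)  R Z = sym (++-assoc Z R′ R)
plug-juxtapose (inC R′ D) R Z = refl
plug-juxtapose (inA R′ D) R Z = refl

plug-⊙ : ∀ E D Z → plug (E ⊙ D) Z ≡ plug E (plug D Z)
plug-⊙ (here R)  D Z = plug-juxtapose D R Z
plug-⊙ (inC R E) D Z = cong (λ W → ccut W ∷ R) (plug-⊙ E D Z)
plug-⊙ (inA R E) D Z = cong (λ W → acut W ∷ R) (plug-⊙ E D Z)

parity-juxtapose : ∀ D R → parity (juxtapose D R) ≡ parity D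
parity-juxtapose (here _)  R = refl
parity-juxtapose (inC _ _) R = refl
parity-juxtapose (inA _ _) R = refl

-- parity is true for even regions, so not (parity E) counts the cuts of E mod 2
parity-⊙ : ∀ E D → parity (E ⊙ D) ≡ not (parity E) xor parity D
parity-⊙ (here R)  D = parity-juxtapose D R
parity-⊙ (inC R E) D = trans (cong not (parity-⊙ E D)) (not-distribˡ-xor (not (parity E)) (parity D))
parity-⊙ (inA R E) D = trans (cong not (parity-⊙ E D)) (not-distribˡ-xor (not (parity E)) (parity D))

parity-⊙-even : ∀ E D → EvenR E → parity (E ⊙ D) ≡ parity D
parity-⊙-even E D even = trans (parity-⊙ E D) (cong (λ b → not b xor parity D) even)

classical-juxtapose : ∀ D R → Classical D → Classical (juxtapose D R)
classical-juxtapose (here _)  R c = c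
classical-juxtapose (inC _ _) R c = c

classical-⊙ : ∀ E D → Classical E → Classical D → Classical (E ⊙ D)
classical-⊙ (here R)  D _  cD = classical-juxtapose D R cD
classical-⊙ (inC R E) D cE cD = classical-⊙ E D cE cD

plug-⟶ : ∀ E → EvenR E → Classical E → ∀ {A B} → A ⟶ B → plug E A ⟶ plug E B
plug-⟶ E even cE = lift
  where
  at : ∀ C {P Q} → plug (E ⊙ C) P ⟶ plug (E ⊙ C) Q → plug E (plug C P) ⟶ plug E (plug C Q)
  at C {P} {Q} = subst₂ _⟶_ (plug-⊙ E C P) (plug-⊙ E C Q)

  same-parity : ∀ {C b} → parity C ≡ b → parity (E ⊙ C) ≡ b
  same-parity {C} = trans (parity-⊙-even E C even)

  lift : ∀ {A B} → A ⟶ B → plug E A ⟶ plug E B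
  lift (perm C p)               = at C (perm (E ⊙ C) p)
  lift (erase₁ C X Y e)         = at C (erase₁ (E ⊙ C) X Y (same-parity e))
  lift (erase₂ C X Y e)         = at C (erase₂ (E ⊙ C) X Y (same-parity e))
  lift (insert₁ C X Y o)        = at C (insert₁ (E ⊙ C) X Y (same-parity o))
  lift (insert₂ C X Y o)        = at C (insert₂ (E ⊙ C) X Y (same-parity o))
  lift (dcut-in C X)            = at C (dcut-in (E ⊙ C) X)
  lift (dcut-out C X)           = at C (dcut-out (E ⊙ C) X)
  lift (a→c C X e)              = at C (a→c (E ⊙ C) X (same-parity e))
  lift (c→a C X o)              = at C (c→a (E ⊙ C) X (same-parity o))
  lift (valid-in C X v)         = at C (valid-in (E ⊙ C) X v)
  lift (valid-out C X v)        = at C (valid-out (E ⊙ C) X v)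
  lift (alt-in C X a e)         = at C (alt-in (E ⊙ C) X a (same-parity e))
  lift (alt-out C X a o)        = at C (alt-out (E ⊙ C) X a (same-parity o))
  lift (dup C X)                = at C (dup (E ⊙ C) X)
  lift (dedup C X)              = at C (dedup (E ⊙ C) X)
  lift (iter C X G Y c)         = at C (iter (E ⊙ C) X G Y (classical-⊙ E C cE c))
  lift (deiter C X G Y c)       = at C (deiter (E ⊙ C) X G Y (classical-⊙ E C cE c))
  lift (alt-iter C X H Y a)     = at C (alt-iter (E ⊙ C) X H Y a)
  lift (alt-deiter C X H Y a)   = at C (alt-deiter (E ⊙ C) X H Y a)

plug-≫ : ∀ E → EvenR E → Classical E → ∀ {A B} → A ≫ B → plug E A ≫ plug E B
plug-≫ E even cE done       = done
plug-≫ E even cE (step r d) = step (plug-⟶ E even cE r) (plug-≫ E even cE d)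

≫-trans : ∀ {A B C} → A ≫ B → B ≫ C → A ≫ C
≫-trans done       e = e
≫-trans (step r d) e = step r (≫-trans d e)

⟶⇒≫ : ∀ {A B} → A ⟶ B → A ≫ B
⟶⇒≫ r = step r done

≫-isPreorder : IsPreorder _≡_ _≫_
≫-isPreorder = record
  { isEquivalence = isEquivalence
  ; reflexive     = λ { refl → done }
  ; trans         = ≫-trans
  }

≫-preorder : Preorder _ _ _
≫-preorder = record { isPreorder = ≫-isPreorder }

open import Relation.Binary.Reasoning.Preorder ≫-preorder

-- Plugging into here [] appends [], so derivations through contexts meet these padded forms.
unpad : ∀ X Y → [ ccut ((X ++ [ ccut (Y ++ []) ]) ++ []) ] ≡ [ ccut (X ++ [ ccut Y ]) ]
unpad X Y rewrite ++-identityʳ Y = cong (λ W → [ ccut W ]) (++-identityʳ (X ++ [ ccut Y ]))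

consequent-≫ : ∀ X {Y Z} → Y ≫ Z → [ ccut (X ++ [ ccut Y ]) ] ≫ [ ccut (X ++ [ ccut Z ]) ]
consequent-≫ X {Y} {Z} d = begin
  [ ccut (X ++ [ ccut Y ]) ]                    ≡⟨ unpad X Y ⟨
  [ ccut ((X ++ [ ccut (Y ++ []) ]) ++ []) ]    ∼⟨ ⟶⇒≫ (perm (inC [] (here [])) (++-comm X _)) ⟩
  [ ccut (ccut (Y ++ []) ∷ X ++ []) ]           ∼⟨ plug-≫ (inC [] (inC (X ++ []) (here []))) refl tt d ⟩
  [ ccut (ccut (Z ++ []) ∷ X ++ []) ]           ∼⟨ ⟶⇒≫ (perm (inC [] (here [])) (++-comm [ ccut (Z ++ []) ] X)) ⟩
  [ ccut ((X ++ [ ccut (Z ++ []) ]) ++ []) ]    ≡⟨ unpad X Z ⟩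
  [ ccut (X ++ [ ccut Z ]) ]                    ∎

implication-refl-valid : ∀ X → Valid [ ccut (X ++ [ ccut X ]) ]
implication-refl-valid X = begin
  []                                            ∼⟨ ⟶⇒≫ (dcut-in (here []) []) ⟩
  [ ccut [ ccut [] ] ]                          ∼⟨ ⟶⇒≫ (insert₂ (inC [] (here [])) _ X refl) ⟩
  [ ccut ((X ++ [ ccut [] ]) ++ []) ]           ∼⟨ ⟶⇒≫ (iter (inC [] (here [])) X (gsuc [] (g0 [])) [] tt) ⟩
  [ ccut ((X ++ [ ccut (X ++ []) ]) ++ []) ]    ≡⟨ unpad X X ⟩
  [ ccut (X ++ [ ccut X ]) ]                    ∎

implication-valid : ∀ X Y → X ≫ Y → Valid [ ccut (X ++ [ ccut Y ]) ]
implication-valid X Y d = ≫-trans (implication-refl-valid X) (consequent-≫ X d)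

alternate-implication-valid : ∀ X Y → IsAlt X → IsAlt Y → X ≫ Y → Valid [ acut (X ++ [ ccut Y ]) ]
alternate-implication-valid X Y _ _ d = begin
  []                                            ∼⟨ valid ⟩
  [ ccut (X ++ [ ccut Y ]) ]                    ∼⟨ ⟶⇒≫ (valid-in (here []) _ valid) ⟩
  [ acut [ ccut [ ccut (X ++ [ ccut Y ]) ] ] ]  ∼⟨ ⟶⇒≫ (dcut-out (inA [] (here [])) (X ++ [ ccut Y ])) ⟩
  [ acut ((X ++ [ ccut Y ]) ++ []) ]            ≡⟨ cong (λ W → [ acut W ]) (++-identityʳ _) ⟩
  [ acut (X ++ [ ccut Y ]) ]                    ∎
  where
  valid : Valid [ ccut (X ++ [ ccut Y ]) ]
  valid = implication-valid X Y d

mainTheorem11 : (∀ X Y → X ≫ Y → Valid [ ccut (X ++ [ ccut Y ]) ])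
    × (∀ X Y → IsAlt X → IsAlt Y → X ≫ Y → Valid [ acut (X ++ [ ccut Y ]) ])
mainTheorem11 = implication-valid , alternate-implication-valid
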